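{- Let $L$ be an abelian Lie ring, $V$ an abelian group and $\phi:L\to \operatorname{End}(V)$ a Lie ring homomorphism (making $V$ an $L$-module), and let $A=L\rtimes V$ be the corresponding semidirect product. Suppose $C_V(L)=C_V(x_1,\dots,x_k)$ for some $x_1,\dots,x_k\in L$. Let $v\in V$ be such that for each $1\le i\le k$ there is an integer $n_i$ with $\operatorname{ad}_{x_i}^{n_i}(v)=0$ in $A$. Then $[L,_m v]=0$ for $m=1+\sum_{i=1}^k(n_i-1)$.
   Context: $\operatorname{End}(V)$ has bracket $[f,g]=f\circ g-g\circ f$. The semidirect product $L\rtimes V$ is $L\times V$ with bracket $[(g,v),(g',v')]=([g,g'],\phi(g)(v')-\phi(g')(v))$; $L$ and $V$ are identified with their images in it. $C_V(X)=\{v\in V:[x,v]=0\ \forall x\in X\}$. $\operatorname{ad}_x(y)=[x,y]$; $[L,_m v]$ is the additive subgroup generated by $\operatorname{ad}_{a_1}\circ\cdots\circ\operatorname{ad}_{a_m}(v)$, $a_1,\dots,a_m\in L$. -}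

module Defs where

open import Level using (Level; _⊔_) renaming (suc to lsuc)
open import Algebra.Bundles using (AbelianGroup)
open import Data.Nat using (ℕ; zero; suc; _∸_)
import Data.Nat as ℕ
open import Data.Fin using (Fin; zero; suc)
open import Data.Product using (_×_; _,_; proj₁; proj₂)
open import Relation.Binary.Core using (Rel)

record LieRing (c ℓ : Level) : Set (lsuc (c ⊔ ℓ)) where
  field
    +-abelianGroup : AbelianGroup c ℓ
  open AbelianGroup +-abelianGroup public
    renaming (_∙_ to _+_; ε to 0#; _⁻¹ to -_)
  field
    ⁅_,_⁆      : Carrier → Carrier → Carrier
    ⁅,⁆-cong   : ∀ {x x′ y y′} → x ≈ x′ → y ≈ y′ → ⁅ x , y ⁆ ≈ ⁅ x′ , y′ ⁆
    ⁅,⁆-distribˡ : ∀ x y z → ⁅ x , y + z ⁆ ≈ ⁅ x , y ⁆ + ⁅ x , z ⁆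
    ⁅,⁆-distribʳ : ∀ x y z → ⁅ x + y , z ⁆ ≈ ⁅ x , z ⁆ + ⁅ y , z ⁆
    ⁅,⁆-alternating : ∀ x → ⁅ x , x ⁆ ≈ 0#
    jacobi : ∀ x y z → (⁅ x , ⁅ y , z ⁆ ⁆ + ⁅ y , ⁅ z , x ⁆ ⁆) + ⁅ z , ⁅ x , y ⁆ ⁆ ≈ 0#

IsAbelianLieRing : ∀ {c ℓ} → LieRing c ℓ → Set (c ⊔ ℓ)
IsAbelianLieRing L = ∀ x y → ⁅ x , y ⁆ ≈ 0#
  where open LieRing L

-- A Lie ring homomorphism φ : L → End(V), where End(V) is the ring of
-- additive endomorphisms of the abelian group V with bracket
-- [f,g] = f ∘ g - g ∘ f (equality of endomorphisms is pointwise).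

record LieHomToEnd {c ℓ c′ ℓ′} (L : LieRing c ℓ) (V : AbelianGroup c′ ℓ′)
       : Set (c ⊔ ℓ ⊔ c′ ⊔ ℓ′) where
  private
    module L = LieRing L
    module V = AbelianGroup V
  field
    φ : L.Carrier → V.Carrier → V.Carrier
    φ-cong-V  : ∀ x {v w} → v V.≈ w → φ x v V.≈ φ x w
    φ-additive-V : ∀ x v w → φ x (v V.∙ w) V.≈ (φ x v V.∙ φ x w)
    φ-cong-L  : ∀ {x y} → x L.≈ y → ∀ v → φ x v V.≈ φ y v
    φ-additive : ∀ x y v → φ (x L.+ y) v V.≈ (φ x v V.∙ φ y v)
    φ-bracket : ∀ x y v →
      φ L.⁅ x , y ⁆ v V.≈ (φ x (φ y v) V.∙ (φ y (φ x v)) V.⁻¹)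

module _ {c ℓ c′ ℓ′} {L : LieRing c ℓ} {V : AbelianGroup c′ ℓ′} where
  private
    module L = LieRing L
    module V = AbelianGroup V

  SD : (φ : LieHomToEnd L V) → Set (c ⊔ c′)
  SD _ = L.Carrier × V.Carrier

  module _ (φ : LieHomToEnd L V) where
    open LieHomToEnd φ using () renaming (φ to act)

    _≈A_ : Rel (SD φ) (ℓ ⊔ ℓ′)
    (g , v) ≈A (g′ , v′) = (g L.≈ g′) × (v V.≈ v′)

    0A : SD φ
    0A = (L.0# , V.ε)

    _+A_ : SD φ → SD φ → SD φ
    (g , v) +A (g′ , v′) = (g L.+ g′ , v V.∙ v′)

    -A_ : SD φ → SD φ
    -A (g , v) = (L.- g , v V.⁻¹)

    ⁅_,_⁆A : SD φ → SD φ → SD φ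
    ⁅ (g , v) , (g′ , v′) ⁆A = (L.⁅ g , g′ ⁆ , (act g v′ V.∙ (act g′ v) V.⁻¹))

    ιL : L.Carrier → SD φ
    ιL x = (x , V.ε)

    ιV : V.Carrier → SD φ
    ιV v = (L.0# , v)

    ad : SD φ → SD φ → SD φ
    ad x y = ⁅ x , y ⁆A

    ad^ : SD φ → ℕ → SD φ → SD φ
    ad^ x zero    y = y
    ad^ x (suc n) y = ad x (ad^ x n y)

    adChain : (m : ℕ) → (Fin m → L.Carrier) → SD φ → SD φ
    adChain zero    a y = y
    adChain (suc m) a y = ad (ιL (a zero)) (adChain m (λ i → a (suc i)) y)

    C_V : ∀ {p} → (L.Carrier → Set p) → V.Carrier → Set (c ⊔ ℓ ⊔ ℓ′ ⊔ p)
    C_V X w = ∀ x → X x → ⁅ ιL x , ιV w ⁆A ≈A 0A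

    -- [L ,_m v] : the additive subgroup of A generated by the elements
    -- ad_{a_1} ∘ ⋯ ∘ ad_{a_m} (v), a_i ∈ L  (membership predicate)
    data InLm (m : ℕ) (v : V.Carrier) : SD φ → Set (c ⊔ c′ ⊔ ℓ ⊔ ℓ′) where
      gen  : ∀ a → InLm m v (adChain m a (ιV v))
      zero : InLm m v 0A
      plus : ∀ {y z} → InLm m v y → InLm m v z → InLm m v (y +A z)
      neg  : ∀ {y} → InLm m v y → InLm m v (-A y)
      resp : ∀ {y z} → y ≈A z → InLm m v y → InLm m v z

Σ-Fin : (k : ℕ) → (Fin k → ℕ) → ℕ
Σ-Fin zero    f = 0
Σ-Fin (suc k) f = f zero ℕ.+ Σ-Fin k (λ i → f (suc i))

-- Write x_i for the action φ(x_i) on V. Because L is abelian the operators φ(a), a ∈ L, pairwise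
-- commute, and [L,_m v] is the subgroup generated by the vectors φ(a₁)⋯φ(a_m) v. Induct on m: the
-- vector w = φ(a₂)⋯φ(a_m) v lies in C_V(x₁,…,x_k) = C_V(L), because x_i w = φ(a₂)⋯φ(a_m)(x_i v),
-- and x_i v is either 0 (when n_i ≤ 1) or satisfies the same hypotheses with n_i lowered by one,
-- so that the excess Σ (n_j − 1) drops by one. Hence φ(a₁) w = 0.
module Submission where

open import Defs
open import Algebra.Bundles using (AbelianGroup)
open import Data.Nat using (ℕ; suc; _∸_)
open import Data.Fin using (Fin)
open import Data.Product using (_×_; Σ)
open import Relation.Binary.PropositionalEquality using (_≡_)
open import Data.Unit.Polymorphic using (⊤)

open import Data.Nat using (zero; pred; _+_; _<_)
open import Data.Nat.Properties using (+-suc; ≤-pred; n<1+n)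
open import Data.Fin using (zero; suc; _≟_)
open import Data.Vec.Functional using (updateAt)
open import Data.Vec.Functional.Properties using (updateAt-updates; updateAt-minimal)
open import Data.Product using (_,_; proj₁; proj₂)
open import Relation.Nullary using (yes; no)
open import Relation.Binary.PropositionalEquality using (refl; sym; trans; cong; subst)
import Algebra.Properties.Group as GroupProperties

excess : ∀ {k} → (Fin k → ℕ) → ℕ
excess {k} n = Σ-Fin k (λ i → n i ∸ 1)

excess-updateAt-pred : ∀ {k} (n : Fin k → ℕ) (i : Fin k) {r} →
  n i ≡ suc (suc r) → excess n ≡ suc (excess (updateAt n i pred))
excess-updateAt-pred n zero    e rewrite e = refl
excess-updateAt-pred n (suc i) e =
  trans (cong (n zero ∸ 1 +_) (excess-updateAt-pred (λ j → n (suc j)) i e))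
        (+-suc (n zero ∸ 1) _)

additive⇒ε↦ε : ∀ {a ℓa b ℓb} (G : AbelianGroup a ℓa) (H : AbelianGroup b ℓb) →
  let module G = AbelianGroup G; module H = AbelianGroup H in
  (f : G.Carrier → H.Carrier) → (∀ {x y} → x G.≈ y → f x H.≈ f y) →
  (∀ x y → f (x G.∙ y) H.≈ (f x H.∙ f y)) → f G.ε H.≈ H.ε
additive⇒ε↦ε G H f f-cong f-additive =
  GroupProperties.identityʳ-unique H.group (f G.ε) (f G.ε)
    (H.trans (H.sym (f-additive G.ε G.ε)) (f-cong (G.identityˡ G.ε)))
  where module G = AbelianGroup G; module H = AbelianGroup H

module LieModule {c ℓ c′ ℓ′} {L : LieRing c ℓ} {V : AbelianGroup c′ ℓ′}
                 (Φ : LieHomToEnd L V) where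
  private
    module L = LieRing L
    module V = AbelianGroup V
  open LieHomToEnd Φ
  open GroupProperties V.group using (ε⁻¹≈ε)

  φ-ε : ∀ a → φ a V.ε V.≈ V.ε
  φ-ε a = additive⇒ε↦ε V V (φ a) (φ-cong-V a) (φ-additive-V a)

  φ-0# : ∀ u → φ L.0# u V.≈ V.ε
  φ-0# u = additive⇒ε↦ε L.+-abelianGroup V (λ a → φ a u) (λ e → φ-cong-L e u)
             (λ a b → φ-additive a b u)

  ⁅-,0#⁆ : ∀ a → L.⁅ a , L.0# ⁆ L.≈ L.0#
  ⁅-,0#⁆ a = additive⇒ε↦ε L.+-abelianGroup L.+-abelianGroup (L.⁅ a ,_⁆)
               (L.⁅,⁆-cong L.refl) (L.⁅,⁆-distribˡ a)

  φ^ : L.Carrier → ℕ → V.Carrier → V.Carrier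
  φ^ a zero    u = u
  φ^ a (suc n) u = φ a (φ^ a n u)

  φChain : (m : ℕ) → (Fin m → L.Carrier) → V.Carrier → V.Carrier
  φChain zero    b u = u
  φChain (suc m) b u = φ (b zero) (φChain m (λ j → b (suc j)) u)

  φChain-cong : ∀ m b {u w} → u V.≈ w → φChain m b u V.≈ φChain m b w
  φChain-cong zero    b e = e
  φChain-cong (suc m) b e = φ-cong-V (b zero) (φChain-cong m _ e)

  φChain-ε : ∀ m b → φChain m b V.ε V.≈ V.ε
  φChain-ε zero    b = V.refl
  φChain-ε (suc m) b = V.trans (φ-cong-V (b zero) (φChain-ε m _)) (φ-ε _)

  ≈A-trans : ∀ {y z w} → _≈A_ Φ y z → _≈A_ Φ z w → _≈A_ Φ y w
  ≈A-trans (e₁ , e₂) (f₁ , f₂) = L.trans e₁ f₁ , V.trans e₂ f₂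

  ad-ιL-resp-ιV : ∀ a {y w} → _≈A_ Φ y (ιV Φ w) →
                  _≈A_ Φ (ad Φ (ιL Φ a) y) (ιV Φ (φ a w))
  ad-ιL-resp-ιV a (g≈0 , u≈w) =
    L.trans (L.⁅,⁆-cong L.refl g≈0) (⁅-,0#⁆ a) ,
    V.trans (V.∙-cong (φ-cong-V a u≈w) (V.⁻¹-cong (φ-ε _)))
            (V.trans (V.∙-congˡ ε⁻¹≈ε) (V.identityʳ _))

  ad^-ιV : ∀ a n w → _≈A_ Φ (ad^ Φ (ιL Φ a) n (ιV Φ w)) (ιV Φ (φ^ a n w))
  ad^-ιV a zero    w = L.refl , V.refl
  ad^-ιV a (suc n) w = ad-ιL-resp-ιV a (ad^-ιV a n w)

  adChain-ιV : ∀ m b w → _≈A_ Φ (adChain Φ m b (ιV Φ w)) (ιV Φ (φChain m b w))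
  adChain-ιV zero    b w = L.refl , V.refl
  adChain-ιV (suc m) b w = ad-ιL-resp-ιV (b zero) (adChain-ιV m _ w)

  ∈C_V⇒φ≈ε : ∀ {p} {X : L.Carrier → Set p} {w} → C_V Φ X w → ∀ a → X a → φ a w V.≈ V.ε
  ∈C_V⇒φ≈ε w∈C a a∈X =
    V.trans (V.sym (proj₂ (ad-ιL-resp-ιV a {ιV Φ _} (L.refl , V.refl)))) (proj₂ (w∈C a a∈X))

  φ≈ε⇒∈C_V : ∀ {p} {X : L.Carrier → Set p} {w} → (∀ a → X a → φ a w V.≈ V.ε) → C_V Φ X w
  φ≈ε⇒∈C_V φ≈ε a a∈X =
    ≈A-trans (ad-ιL-resp-ιV a {ιV Φ _} (L.refl , V.refl)) (L.refl , φ≈ε a a∈X)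

  InLm⇒≈0A : ∀ {m v y} → (∀ b → _≈A_ Φ (adChain Φ m b (ιV Φ v)) (0A Φ)) →
             InLm Φ m v y → _≈A_ Φ y (0A Φ)
  InLm⇒≈0A gen≈0 (gen b)    = gen≈0 b
  InLm⇒≈0A gen≈0 zero       = L.refl , V.refl
  InLm⇒≈0A gen≈0 (plus p q) with InLm⇒≈0A gen≈0 p | InLm⇒≈0A gen≈0 q
  ... | p₁ , p₂ | q₁ , q₂ = L.trans (L.∙-cong p₁ q₁) (L.identityˡ _) ,
                            V.trans (V.∙-cong p₂ q₂) (V.identityˡ _)
  InLm⇒≈0A gen≈0 (neg p)    with InLm⇒≈0A gen≈0 p
  ... | p₁ , p₂ = L.trans (L.⁻¹-cong p₁) (GroupProperties.ε⁻¹≈ε L.group) ,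
                  V.trans (V.⁻¹-cong p₂) ε⁻¹≈ε
  InLm⇒≈0A gen≈0 (resp e p) with InLm⇒≈0A gen≈0 p
  ... | p₁ , p₂ = L.trans (L.sym (proj₁ e)) p₁ , V.trans (V.sym (proj₂ e)) p₂

module AbelianLieModule {c ℓ c′ ℓ′} {L : LieRing c ℓ} {V : AbelianGroup c′ ℓ′}
                        (abelian : IsAbelianLieRing L) (Φ : LieHomToEnd L V) where
  private
    module L = LieRing L
    module V = AbelianGroup V
  open LieHomToEnd Φ
  open LieModule Φ

  φ-comm : ∀ a b u → φ a (φ b u) V.≈ φ b (φ a u)
  φ-comm a b u = GroupProperties.x∙y⁻¹≈ε⇒x≈y V.group _ _
    (V.trans (V.sym (φ-bracket a b u)) (V.trans (φ-cong-L (abelian a b) u) (φ-0# u)))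

  φ^-φ : ∀ a n b u → φ^ a n (φ b u) V.≈ φ b (φ^ a n u)
  φ^-φ a zero    b u = V.refl
  φ^-φ a (suc n) b u = V.trans (φ-cong-V a (φ^-φ a n b u)) (φ-comm a b _)

  φChain-φ : ∀ m b a u → φChain m b (φ a u) V.≈ φ a (φChain m b u)
  φChain-φ zero    b a u = V.refl
  φChain-φ (suc m) b a u = V.trans (φ-cong-V (b zero) (φChain-φ m _ a u)) (φ-comm (b zero) a _)

  module _ {k} (x : Fin k → L.Carrier) where

    AnnihilatedBy : (Fin k → ℕ) → V.Carrier → Set ℓ′
    AnnihilatedBy n v = ∀ i → φ^ (x i) (n i) v V.≈ V.ε

    annihilatedBy-φ : ∀ n {v} → AnnihilatedBy n v → ∀ i {r} → n i ≡ suc r →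
                      AnnihilatedBy (updateAt n i pred) (φ (x i) v)
    annihilatedBy-φ n {v} ann i {r} e j with i ≟ j
    ... | yes refl rewrite updateAt-updates i {pred} n | e =
      V.trans (φ^-φ (x i) r (x i) v) (subst (λ t → φ^ (x i) t v V.≈ V.ε) e (ann i))
    ... | no i≢j rewrite updateAt-minimal j i {pred} n (λ j≡i → i≢j (sym j≡i)) =
      V.trans (φ^-φ (x j) (n j) (x i) v) (V.trans (φ-cong-V (x i) (ann j)) (φ-ε _))

  module _ {k} (x : Fin k → L.Carrier)
           (C_V-x⊆C_V-L : ∀ w → C_V Φ (λ y → Σ (Fin k) (λ i → x i ≡ y)) w →
                                         C_V Φ (λ _ → ⊤ {ℓ = c}) w) where

    φChain-annihilated : ∀ m n {v} → excess n < m → AnnihilatedBy x n v →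
                         ∀ b → φChain m b v V.≈ V.ε
    φChain-φ-annihilated : ∀ m n {v} → excess n < suc m → AnnihilatedBy x n v →
                           ∀ b i → φChain m b (φ (x i) v) V.≈ V.ε

    φChain-annihilated zero    n () ann b
    φChain-annihilated (suc m) n {v} lt ann b =
      ∈C_V⇒φ≈ε (C_V-x⊆C_V-L _ (φ≈ε⇒∈C_V w∈C_V)) (b zero) _
      where
      w∈C_V : ∀ a → Σ (Fin k) (λ i → x i ≡ a) → φ a (φChain m _ v) V.≈ V.ε
      w∈C_V a (i , refl) =
        V.trans (V.sym (φChain-φ m _ (x i) v)) (φChain-φ-annihilated m n lt ann _ i)

    φChain-φ-annihilated m n {v} lt ann b i with n i in e | ann i
    ... | zero | v≈ε =
      V.trans (φChain-cong m b (V.trans (φ-cong-V (x i) v≈ε) (φ-ε _))) (φChain-ε m b)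
    ... | suc zero | xv≈ε = V.trans (φChain-cong m b xv≈ε) (φChain-ε m b)
    ... | suc (suc r) | _ =
      φChain-annihilated m (updateAt n i pred)
        (≤-pred (subst (_< suc m) (excess-updateAt-pred n i e) lt)) (annihilatedBy-φ x n ann i e) b

mainTheorem10 : ∀ {c ℓ c′ ℓ′} (L : LieRing c ℓ) (V : AbelianGroup c′ ℓ′)
    → IsAbelianLieRing L
    → (φ : LieHomToEnd L V)
    → (k : ℕ) (x : Fin k → LieRing.Carrier L)
    → (∀ w → (C_V φ (λ _ → ⊤ {ℓ = c}) w → C_V φ (λ y → Σ (Fin k) (λ i → x i ≡ y)) w)
    × (C_V φ (λ y → Σ (Fin k) (λ i → x i ≡ y)) w → C_V φ (λ _ → ⊤ {ℓ = c}) w))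
    → (v : AbelianGroup.Carrier V) (n : Fin k → ℕ)
    → (∀ i → _≈A_ φ (ad^ φ (ιL φ (x i)) (n i) (ιV φ v)) (0A φ))
    → ∀ y → InLm φ (suc (Σ-Fin k (λ i → n i ∸ 1))) v y → _≈A_ φ y (0A φ)
mainTheorem10 {c} L V abelian φ k x C_V-L⇔C_V-x v n ad^≈0 _ =
  InLm⇒≈0A (λ b → ≈A-trans (adChain-ιV _ b v)
                     (L.refl , φChain-annihilated x C_V-x⊆C_V-L _ n (n<1+n _) annihilated b))
  where
  module L = LieRing L
  module V = AbelianGroup V
  open LieModule φ
  open AbelianLieModule abelian φ

  C_V-x⊆C_V-L : ∀ w → C_V φ (λ y → Σ (Fin k) (λ i → x i ≡ y)) w → C_V φ (λ _ → ⊤ {ℓ = c}) w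
  C_V-x⊆C_V-L w = proj₂ (C_V-L⇔C_V-x w)

  annihilated : AnnihilatedBy x n v
  annihilated i = V.trans (V.sym (proj₂ (ad^-ιV (x i) (n i) v))) (proj₂ (ad^≈0 i))
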